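{- Let $s\ge 1$ and let $n_1,\dots,n_s,k_1,\dots,k_s$ be positive integers. Then there exist finitely many polynomials $g_i\in\mathbb{Q}[X]$ and positive integers $m_i,\ell_i$ with $\ell_i\le n_1+\cdots+n_s$ for every $i$, such that $$\frac{1}{(X^{k_1}-1)^{n_1}\cdots(X^{k_s}-1)^{n_s}}=\sum_i\frac{g_i}{(X^{m_i}-1)^{\ell_i}}$$ as an identity of rational functions in $\mathbb{Q}(X)$. -}

module Defs where

open import Data.Nat using (ℕ; zero; suc)
open import Data.Rational using (ℚ; 0ℚ; 1ℚ; -_) renaming (_+_ to _+ℚ_; _*_ to _*ℚ_)
open import Data.List using (List; []; _∷_; map; replicate; _++_; [_]; foldr; allFin)
open import Data.Nat.ListAction using (sum)
open import Data.Fin using (Fin)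
open import Data.Product using (_×_; _,_)
open import Relation.Binary.PropositionalEquality using (_≡_)

-- Polynomials in ℚ[X] as coefficient lists, lowest degree first.
-- Trailing zeros are allowed; equality is coefficientwise (see _≈ₚ_).
Poly : Set
Poly = List ℚ

coeff : Poly → ℕ → ℚ
coeff []       _       = 0ℚ
coeff (a ∷ p)  zero    = a
coeff (a ∷ p)  (suc i) = coeff p i

_≈ₚ_ : Poly → Poly → Set
p ≈ₚ q = ∀ i → coeff p i ≡ coeff q i

infixl 6 _+ₚ_
infixl 7 _*ₚ_

_+ₚ_ : Poly → Poly → Poly
[]      +ₚ q       = q
(a ∷ p) +ₚ []      = a ∷ p
(a ∷ p) +ₚ (b ∷ q) = (a +ℚ b) ∷ (p +ₚ q)

_*ₚ_ : Poly → Poly → Poly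
[]      *ₚ q = []
(a ∷ p) *ₚ q = map (a *ℚ_) q +ₚ (0ℚ ∷ (p *ₚ q))

oneₚ : Poly
oneₚ = [ 1ℚ ]

zeroₚ : Poly
zeroₚ = []

Xpow : ℕ → Poly
Xpow k = replicate k 0ℚ ++ [ 1ℚ ]

XpowMinus1 : ℕ → Poly
XpowMinus1 k = Xpow k +ₚ [ - 1ℚ ]

_^ₚ_ : Poly → ℕ → Poly
p ^ₚ zero  = oneₚ
p ^ₚ suc n = p *ₚ (p ^ₚ n)

-- Elements of ℚ(X) represented as fractions num / den
-- (all denominators used below are of the form (X^m - 1)^ℓ with m ≥ 1, hence nonzero).
record Frac : Set where
  constructor _//_
  field
    num : Poly
    den : Poly
open Frac public

_≃_ : Frac → Frac → Set
(a // b) ≃ (c // d) = (a *ₚ d) ≈ₚ (c *ₚ b)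

_+F_ : Frac → Frac → Frac
(a // b) +F (c // d) = ((a *ₚ d) +ₚ (c *ₚ b)) // (b *ₚ d)

sumF : List Frac → Frac
sumF = foldr _+F_ (zeroₚ // oneₚ)

denom : (s : ℕ) → (Fin s → ℕ) → (Fin s → ℕ) → Poly
denom s n k = foldr (λ j acc → (XpowMinus1 (k j) ^ₚ n j) *ₚ acc) oneₚ (allFin s)

sumFin : (s : ℕ) → (Fin s → ℕ) → ℕ
sumFin s n = sum (map n (allFin s))

term : Poly × ℕ × ℕ → Frac
term (g , m , ℓ) = g // (XpowMinus1 m ^ₚ ℓ)

module Submission where

-- Put M = k₁ ⋯ k_s and L = n₁ + ⋯ + n_s.  Since k_j ∣ M, the
-- polynomial X^{k_j} - 1 divides X^M - 1 (geometric series), hence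
-- (X^{k_j} - 1)^{n_j} divides (X^M - 1)^{n_j}, and multiplying over j shows
-- that the denominator D = ∏ (X^{k_j} - 1)^{n_j} divides (X^M - 1)^L, say
-- (X^M - 1)^L = g · D.  Then 1 / D = g / (X^M - 1)^L is the required
-- decomposition, with a single term whose exponent is exactly L.

open import Defs
open import Data.Nat using (ℕ; _≤_; zero; suc)
import Data.Nat as ℕ
open import Data.Nat.Properties using (≤-refl; ≤-trans; m≤m+n; *-mono-≤)
open import Data.Nat.Divisibility using (_∣_; divides)
open import Data.Nat.ListAction using (sum; product)
open import Data.Nat.ListAction.Properties using (∈⇒∣product)
open import Data.Fin using (Fin) renaming (zero to fzero)
open import Data.List using (List; []; _∷_; [_]; map; foldr; allFin)
open import Data.List.Relation.Unary.All using (All; []; _∷_)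
open import Data.List.Membership.Propositional.Properties using (∈-map⁺; ∈-allFin)
open import Data.Product using (Σ; _×_; _,_; proj₁; proj₂; ∃-syntax)
open import Data.Rational using (ℚ; 0ℚ; 1ℚ; -_) renaming (_+_ to _+ℚ_; _*_ to _*ℚ_)
open import Data.Rational.Properties using (+-identityˡ; +-identityʳ; *-zeroˡ; *-zeroʳ)
open import Data.Rational.Solver using (module +-*-Solver)
open +-*-Solver using (solve; _:+_; _:*_; _:=_; con)
open import Relation.Binary.PropositionalEquality
  using (_≡_; refl; sym; trans; cong; cong₂; module ≡-Reasoning)
open import Relation.Binary.Bundles using (Setoid)
import Relation.Binary.Reasoning.Setoid as SetoidReasoning

-- _≈ₚ_ wrapped in a record: unlike the bare function type, the record
-- remembers both polynomials, so Agda can infer them from a proof.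
record _≋_ (p q : Poly) : Set where
  constructor mk
  field at : p ≈ₚ q
open _≋_ public
infix 4 _≋_

≋-refl : ∀ {p} → p ≋ p
≋-refl = mk λ i → refl

≋-sym : ∀ {p q} → p ≋ q → q ≋ p
≋-sym h = mk λ i → sym (at h i)

≋-trans : ∀ {p q r} → p ≋ q → q ≋ r → p ≋ r
≋-trans h g = mk λ i → trans (at h i) (at g i)

PolySetoid : Setoid _ _
PolySetoid = record
  { Carrier = Poly ; _≈_ = _≋_
  ; isEquivalence = record { refl = ≋-refl ; sym = ≋-sym ; trans = ≋-trans } }

+ₚ-coeff : ∀ p q i → coeff (p +ₚ q) i ≡ coeff p i +ℚ coeff q i
+ₚ-coeff []      q       i       = sym (+-identityˡ _)
+ₚ-coeff (a ∷ p) []      zero    = sym (+-identityʳ a)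
+ₚ-coeff (a ∷ p) []      (suc i) = sym (+-identityʳ _)
+ₚ-coeff (a ∷ p) (b ∷ q) zero    = refl
+ₚ-coeff (a ∷ p) (b ∷ q) (suc i) = +ₚ-coeff p q i

scale-coeff : ∀ a q i → coeff (map (a *ℚ_) q) i ≡ a *ℚ coeff q i
scale-coeff a []      i       = sym (*-zeroʳ a)
scale-coeff a (b ∷ q) zero    = refl
scale-coeff a (b ∷ q) (suc i) = scale-coeff a q i

*ₚ-coeff : ∀ a p q i → coeff ((a ∷ p) *ₚ q) i ≡ a *ℚ coeff q i +ℚ coeff (0ℚ ∷ (p *ₚ q)) i
*ₚ-coeff a p q i = trans (+ₚ-coeff (map (a *ℚ_) q) (0ℚ ∷ (p *ₚ q)) i)
  (cong (_+ℚ coeff (0ℚ ∷ (p *ₚ q)) i) (scale-coeff a q i))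

∷-cong : ∀ {x y p q} → x ≡ y → p ≋ q → (x ∷ p) ≋ (y ∷ q)
∷-cong e h = mk λ { zero → e ; (suc i) → at h i }

∷-tail : ∀ {a b p q} → (a ∷ p) ≋ (b ∷ q) → p ≋ q
∷-tail h = mk λ i → at h (suc i)

∷-tail-zero : ∀ {a p} → (a ∷ p) ≋ [] → p ≋ []
∷-tail-zero h = mk λ i → at h (suc i)

0∷-zero : ∀ {r} → r ≋ [] → (0ℚ ∷ r) ≋ []
0∷-zero h = mk λ { zero → refl ; (suc i) → at h i }

+ₚ-cong : ∀ {p p' q q'} → p ≋ p' → q ≋ q' → (p +ₚ q) ≋ (p' +ₚ q')
+ₚ-cong {p} {p'} {q} {q'} h g = mk λ i →
  trans (+ₚ-coeff p q i) (trans (cong₂ _+ℚ_ (at h i) (at g i)) (sym (+ₚ-coeff p' q' i)))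

+ₚ-identityʳ : ∀ p → (p +ₚ []) ≋ p
+ₚ-identityʳ []      = ≋-refl
+ₚ-identityʳ (a ∷ p) = ≋-refl

-- A polynomial that is zero coefficientwise annihilates every q; this is
-- needed because the list representation allows trailing zeros.
*ₚ-zeroˡ : ∀ p q → p ≋ [] → (p *ₚ q) ≋ []
*ₚ-zeroˡ []      q h = ≋-refl
*ₚ-zeroˡ (a ∷ p) q h = mk λ i → begin
    coeff ((a ∷ p) *ₚ q) i                     ≡⟨ *ₚ-coeff a p q i ⟩
    a *ℚ coeff q i +ℚ coeff (0ℚ ∷ (p *ₚ q)) i
      ≡⟨ cong₂ _+ℚ_ (cong (_*ℚ coeff q i) (at h zero))
                    (at (0∷-zero (*ₚ-zeroˡ p q (∷-tail-zero h))) i) ⟩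
    0ℚ *ℚ coeff q i +ℚ 0ℚ                      ≡⟨ solve 1 (λ x → con 0ℚ :* x :+ con 0ℚ := con 0ℚ) refl (coeff q i) ⟩
    0ℚ                                         ∎
  where open ≡-Reasoning

*ₚ-congˡ : ∀ p p' q → p ≋ p' → (p *ₚ q) ≋ (p' *ₚ q)
*ₚ-congˡ []      p'       q h = ≋-sym (*ₚ-zeroˡ p' q (≋-sym h))
*ₚ-congˡ (a ∷ p) []       q h = *ₚ-zeroˡ (a ∷ p) q h
*ₚ-congˡ (a ∷ p) (b ∷ p') q h = mk λ i →
  trans (*ₚ-coeff a p q i) (trans
    (cong₂ _+ℚ_ (cong (_*ℚ coeff q i) (at h zero)) (at (∷-cong refl (*ₚ-congˡ p p' q (∷-tail h))) i))
    (sym (*ₚ-coeff b p' q i)))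

*ₚ-congʳ : ∀ p q q' → q ≋ q' → (p *ₚ q) ≋ (p *ₚ q')
*ₚ-congʳ []      q q' h = ≋-refl
*ₚ-congʳ (a ∷ p) q q' h = mk λ i →
  trans (*ₚ-coeff a p q i) (trans
    (cong₂ _+ℚ_ (cong (a *ℚ_) (at h i)) (at (∷-cong refl (*ₚ-congʳ p q q' h)) i))
    (sym (*ₚ-coeff a p q' i)))

*ₚ-cong : ∀ {p p' q q'} → p ≋ p' → q ≋ q' → (p *ₚ q) ≋ (p' *ₚ q')
*ₚ-cong {p} {p'} {q} {q'} h g = ≋-trans (*ₚ-congˡ p p' q h) (*ₚ-congʳ p' q q' g)

*ₚ-distribʳ : ∀ p p' q → ((p +ₚ p') *ₚ q) ≋ ((p *ₚ q) +ₚ (p' *ₚ q))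
*ₚ-distribʳ []      p'       q = ≋-refl
*ₚ-distribʳ (a ∷ p) []       q = ≋-sym (+ₚ-identityʳ _)
*ₚ-distribʳ (a ∷ p) (b ∷ p') q = mk coeffwise
  where
  coeffwise : ∀ i → coeff (((a ∷ p) +ₚ (b ∷ p')) *ₚ q) i ≡ coeff (((a ∷ p) *ₚ q) +ₚ ((b ∷ p') *ₚ q)) i
  coeffwise i = begin
      coeff (((a +ℚ b) ∷ (p +ₚ p')) *ₚ q) i      ≡⟨ *ₚ-coeff (a +ℚ b) (p +ₚ p') q i ⟩
      (a +ℚ b) *ℚ coeff q i +ℚ coeff (0ℚ ∷ ((p +ₚ p') *ₚ q)) i
        ≡⟨ cong ((a +ℚ b) *ℚ coeff q i +ℚ_)
            (trans (at (∷-cong (sym (+-identityʳ 0ℚ)) (*ₚ-distribʳ p p' q)) i)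
                   (+ₚ-coeff (0ℚ ∷ (p *ₚ q)) (0ℚ ∷ (p' *ₚ q)) i)) ⟩
      (a +ℚ b) *ℚ x +ℚ (u +ℚ v)
        ≡⟨ solve 5 (λ a b x u v → (a :+ b) :* x :+ (u :+ v) := (a :* x :+ u) :+ (b :* x :+ v)) refl a b x u v ⟩
      (a *ℚ x +ℚ u) +ℚ (b *ℚ x +ℚ v)
        ≡⟨ sym (cong₂ _+ℚ_ (*ₚ-coeff a p q i) (*ₚ-coeff b p' q i)) ⟩
      coeff ((a ∷ p) *ₚ q) i +ℚ coeff ((b ∷ p') *ₚ q) i
        ≡⟨ sym (+ₚ-coeff ((a ∷ p) *ₚ q) ((b ∷ p') *ₚ q) i) ⟩
      coeff (((a ∷ p) *ₚ q) +ₚ ((b ∷ p') *ₚ q)) i ∎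
    where
    open ≡-Reasoning
    x = coeff q i
    u = coeff (0ℚ ∷ (p *ₚ q)) i
    v = coeff (0ℚ ∷ (p' *ₚ q)) i

*ₚ-distribˡ : ∀ p q r → (p *ₚ (q +ₚ r)) ≋ ((p *ₚ q) +ₚ (p *ₚ r))
*ₚ-distribˡ []      q r = ≋-refl
*ₚ-distribˡ (a ∷ p) q r = mk coeffwise
  where
  coeffwise : ∀ i → coeff ((a ∷ p) *ₚ (q +ₚ r)) i ≡ coeff (((a ∷ p) *ₚ q) +ₚ ((a ∷ p) *ₚ r)) i
  coeffwise i = begin
      coeff ((a ∷ p) *ₚ (q +ₚ r)) i              ≡⟨ *ₚ-coeff a p (q +ₚ r) i ⟩
      a *ℚ coeff (q +ₚ r) i +ℚ coeff (0ℚ ∷ (p *ₚ (q +ₚ r))) i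
        ≡⟨ cong₂ _+ℚ_ (cong (a *ℚ_) (+ₚ-coeff q r i))
            (trans (at (∷-cong (sym (+-identityʳ 0ℚ)) (*ₚ-distribˡ p q r)) i)
                   (+ₚ-coeff (0ℚ ∷ (p *ₚ q)) (0ℚ ∷ (p *ₚ r)) i)) ⟩
      a *ℚ (x +ℚ y) +ℚ (u +ℚ v)
        ≡⟨ solve 5 (λ a x y u v → a :* (x :+ y) :+ (u :+ v) := (a :* x :+ u) :+ (a :* y :+ v)) refl a x y u v ⟩
      (a *ℚ x +ℚ u) +ℚ (a *ℚ y +ℚ v)
        ≡⟨ sym (cong₂ _+ℚ_ (*ₚ-coeff a p q i) (*ₚ-coeff a p r i)) ⟩
      coeff ((a ∷ p) *ₚ q) i +ℚ coeff ((a ∷ p) *ₚ r) i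
        ≡⟨ sym (+ₚ-coeff ((a ∷ p) *ₚ q) ((a ∷ p) *ₚ r) i) ⟩
      coeff (((a ∷ p) *ₚ q) +ₚ ((a ∷ p) *ₚ r)) i ∎
    where
    open ≡-Reasoning
    x = coeff q i
    y = coeff r i
    u = coeff (0ℚ ∷ (p *ₚ q)) i
    v = coeff (0ℚ ∷ (p *ₚ r)) i

*ₚ-identityˡ : ∀ p → (oneₚ *ₚ p) ≋ p
*ₚ-identityˡ p = mk λ i → trans (*ₚ-coeff 1ℚ [] p i) (unit i)
  where
  unit : ∀ i → 1ℚ *ℚ coeff p i +ℚ coeff (0ℚ ∷ []) i ≡ coeff p i
  unit zero    = solve 1 (λ x → con 1ℚ :* x :+ con 0ℚ := x) refl (coeff p zero)
  unit (suc i) = solve 1 (λ x → con 1ℚ :* x :+ con 0ℚ := x) refl (coeff p (suc i))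

*ₚ-zeroʳ : ∀ p → (p *ₚ []) ≋ []
*ₚ-zeroʳ []      = ≋-refl
*ₚ-zeroʳ (a ∷ p) = 0∷-zero (*ₚ-zeroʳ p)

X*ₚ-shiftˡ : ∀ u r → ((0ℚ ∷ u) *ₚ r) ≋ (0ℚ ∷ (u *ₚ r))
X*ₚ-shiftˡ u r = +ₚ-cong {map (0ℚ *ℚ_) r} {[]} scaled-zero ≋-refl
  where
  scaled-zero : map (0ℚ *ℚ_) r ≋ []
  scaled-zero = mk λ i → trans (scale-coeff 0ℚ r i) (*-zeroˡ (coeff r i))

X*ₚ-shiftʳ : ∀ p q → (p *ₚ (0ℚ ∷ q)) ≋ (0ℚ ∷ (p *ₚ q))
X*ₚ-shiftʳ []      q = ≋-sym (0∷-zero ≋-refl)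
X*ₚ-shiftʳ (a ∷ p) q = mk λ
  { zero    → trans (*ₚ-coeff a p (0ℚ ∷ q) zero) (solve 1 (λ a → a :* con 0ℚ :+ con 0ℚ := con 0ℚ) refl a)
  ; (suc i) → trans (*ₚ-coeff a p (0ℚ ∷ q) (suc i))
                (trans (cong (a *ℚ coeff q i +ℚ_) (at (X*ₚ-shiftʳ p q) i)) (sym (*ₚ-coeff a p q i))) }

*ₚ-constʳ : ∀ p b → (p *ₚ [ b ]) ≋ map (b *ℚ_) p
*ₚ-constʳ []      b = ≋-refl
*ₚ-constʳ (a ∷ p) b = mk λ
  { zero    → trans (*ₚ-coeff a p [ b ] zero) (solve 2 (λ a b → a :* b :+ con 0ℚ := b :* a) refl a b)
  ; (suc i) → trans (*ₚ-coeff a p [ b ] (suc i))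
                (trans (cong (a *ℚ 0ℚ +ℚ_) (at (*ₚ-constʳ p b) i))
                       (solve 2 (λ a y → a :* con 0ℚ :+ y := y) refl a (coeff (map (b *ℚ_) p) i))) }

scale-*ₚ : ∀ a q r → (map (a *ℚ_) q *ₚ r) ≋ map (a *ℚ_) (q *ₚ r)
scale-*ₚ a []      r = ≋-refl
scale-*ₚ a (b ∷ q) r = mk coeffwise
  where
  coeffwise : ∀ i → coeff (map (a *ℚ_) (b ∷ q) *ₚ r) i ≡ coeff (map (a *ℚ_) ((b ∷ q) *ₚ r)) i
  coeffwise i = begin
      coeff ((a *ℚ b ∷ map (a *ℚ_) q) *ₚ r) i    ≡⟨ *ₚ-coeff (a *ℚ b) (map (a *ℚ_) q) r i ⟩
      (a *ℚ b) *ℚ x +ℚ coeff (0ℚ ∷ (map (a *ℚ_) q *ₚ r)) i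
        ≡⟨ cong ((a *ℚ b) *ℚ x +ℚ_)
             (trans (at (∷-cong (sym (*-zeroʳ a)) (scale-*ₚ a q r)) i) (scale-coeff a (0ℚ ∷ (q *ₚ r)) i)) ⟩
      (a *ℚ b) *ℚ x +ℚ a *ℚ y
        ≡⟨ solve 4 (λ a b x y → (a :* b) :* x :+ a :* y := a :* (b :* x :+ y)) refl a b x y ⟩
      a *ℚ (b *ℚ x +ℚ y)                         ≡⟨ cong (a *ℚ_) (sym (*ₚ-coeff b q r i)) ⟩
      a *ℚ coeff ((b ∷ q) *ₚ r) i                ≡⟨ sym (scale-coeff a ((b ∷ q) *ₚ r) i) ⟩
      coeff (map (a *ℚ_) ((b ∷ q) *ₚ r)) i       ∎
    where
    open ≡-Reasoning
    x = coeff r i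
    y = coeff (0ℚ ∷ (q *ₚ r)) i

*ₚ-comm : ∀ p q → (p *ₚ q) ≋ (q *ₚ p)
*ₚ-comm []      q = ≋-sym (*ₚ-zeroʳ q)
*ₚ-comm (a ∷ p) q = ≋-sym (begin
    q *ₚ (a ∷ p)                      ≈⟨ *ₚ-congʳ q (a ∷ p) ([ a ] +ₚ (0ℚ ∷ p)) (∷-cong (sym (+-identityʳ a)) ≋-refl) ⟩
    q *ₚ ([ a ] +ₚ (0ℚ ∷ p))          ≈⟨ *ₚ-distribˡ q [ a ] (0ℚ ∷ p) ⟩
    (q *ₚ [ a ]) +ₚ (q *ₚ (0ℚ ∷ p))   ≈⟨ +ₚ-cong (*ₚ-constʳ q a) (X*ₚ-shiftʳ q p) ⟩
    map (a *ℚ_) q +ₚ (0ℚ ∷ (q *ₚ p))  ≈⟨ +ₚ-cong {map (a *ℚ_) q} ≋-refl (∷-cong refl (*ₚ-comm q p)) ⟩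
    (a ∷ p) *ₚ q                      ∎)
  where open SetoidReasoning PolySetoid

*ₚ-assoc : ∀ p q r → ((p *ₚ q) *ₚ r) ≋ (p *ₚ (q *ₚ r))
*ₚ-assoc []      q r = ≋-refl
*ₚ-assoc (a ∷ p) q r = begin
    (map (a *ℚ_) q +ₚ (0ℚ ∷ (p *ₚ q))) *ₚ r         ≈⟨ *ₚ-distribʳ (map (a *ℚ_) q) (0ℚ ∷ (p *ₚ q)) r ⟩
    (map (a *ℚ_) q *ₚ r) +ₚ ((0ℚ ∷ (p *ₚ q)) *ₚ r)  ≈⟨ +ₚ-cong (scale-*ₚ a q r) (X*ₚ-shiftˡ (p *ₚ q) r) ⟩
    map (a *ℚ_) (q *ₚ r) +ₚ (0ℚ ∷ ((p *ₚ q) *ₚ r))  ≈⟨ +ₚ-cong {map (a *ℚ_) (q *ₚ r)} ≋-refl (∷-cong refl (*ₚ-assoc p q r)) ⟩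
    (a ∷ p) *ₚ (q *ₚ r)                             ∎
  where open SetoidReasoning PolySetoid

*ₚ-identityʳ : ∀ p → (p *ₚ oneₚ) ≋ p
*ₚ-identityʳ p = ≋-trans (*ₚ-comm p oneₚ) (*ₚ-identityˡ p)

*ₚ-interchange : ∀ A B C D → ((A *ₚ B) *ₚ (C *ₚ D)) ≋ ((A *ₚ C) *ₚ (B *ₚ D))
*ₚ-interchange A B C D = begin
    (A *ₚ B) *ₚ (C *ₚ D)  ≈⟨ *ₚ-assoc A B (C *ₚ D) ⟩
    A *ₚ (B *ₚ (C *ₚ D))  ≈⟨ *ₚ-congʳ A _ _ (≋-sym (*ₚ-assoc B C D)) ⟩
    A *ₚ ((B *ₚ C) *ₚ D)  ≈⟨ *ₚ-congʳ A _ _ (*ₚ-congˡ (B *ₚ C) (C *ₚ B) D (*ₚ-comm B C)) ⟩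
    A *ₚ ((C *ₚ B) *ₚ D)  ≈⟨ *ₚ-congʳ A _ _ (*ₚ-assoc C B D) ⟩
    A *ₚ (C *ₚ (B *ₚ D))  ≈⟨ ≋-sym (*ₚ-assoc A C (B *ₚ D)) ⟩
    (A *ₚ C) *ₚ (B *ₚ D)  ∎
  where open SetoidReasoning PolySetoid

^ₚ-+ : ∀ p a b → (p ^ₚ (a ℕ.+ b)) ≋ ((p ^ₚ a) *ₚ (p ^ₚ b))
^ₚ-+ p zero    b = ≋-sym (*ₚ-identityˡ _)
^ₚ-+ p (suc a) b = ≋-trans (*ₚ-congʳ p _ _ (^ₚ-+ p a b)) (≋-sym (*ₚ-assoc p (p ^ₚ a) (p ^ₚ b)))

Xpow-+ : ∀ a b → Xpow (a ℕ.+ b) ≋ (Xpow a *ₚ Xpow b)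
Xpow-+ zero    b = ≋-sym (*ₚ-identityˡ _)
Xpow-+ (suc a) b = ≋-trans (∷-cong refl (Xpow-+ a b)) (≋-sym (X*ₚ-shiftˡ (Xpow a) (Xpow b)))

-- X^{a+c} - 1 = X^c (X^a - 1) + (X^c - 1): the step of the geometric series.
XpowMinus1-+ : ∀ a c → XpowMinus1 (a ℕ.+ c) ≋ ((Xpow c *ₚ XpowMinus1 a) +ₚ XpowMinus1 c)
XpowMinus1-+ a c = mk coeffwise
  where
  coeffwise : ∀ i → coeff (XpowMinus1 (a ℕ.+ c)) i ≡ coeff ((Xpow c *ₚ XpowMinus1 a) +ₚ XpowMinus1 c) i
  coeffwise i = begin
      coeff (Xpow (a ℕ.+ c) +ₚ [ - 1ℚ ]) i        ≡⟨ +ₚ-coeff (Xpow (a ℕ.+ c)) [ - 1ℚ ] i ⟩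
      coeff (Xpow (a ℕ.+ c)) i +ℚ m               ≡⟨ cong (_+ℚ m) (at (≋-trans (Xpow-+ a c) (*ₚ-comm (Xpow a) U)) i) ⟩
      w +ℚ m                                      ≡⟨ solve 3 (λ u m w → w :+ m := (w :+ con (- 1ℚ) :* u) :+ (u :+ m)) refl u m w ⟩
      (w +ℚ (- 1ℚ) *ℚ u) +ℚ (u +ℚ m)              ≡⟨ sym (cong₂ _+ℚ_ scaled (+ₚ-coeff U [ - 1ℚ ] i)) ⟩
      coeff (U *ₚ XpowMinus1 a) i +ℚ coeff (XpowMinus1 c) i
        ≡⟨ sym (+ₚ-coeff (U *ₚ XpowMinus1 a) (XpowMinus1 c) i) ⟩
      coeff ((U *ₚ XpowMinus1 a) +ₚ XpowMinus1 c) i ∎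
    where
    open ≡-Reasoning
    U = Xpow c
    u = coeff U i
    m = coeff [ - 1ℚ ] i
    w = coeff (U *ₚ Xpow a) i
    scaled : coeff (U *ₚ XpowMinus1 a) i ≡ w +ℚ (- 1ℚ) *ℚ u
    scaled = trans (at (*ₚ-distribˡ U (Xpow a) [ - 1ℚ ]) i)
      (trans (+ₚ-coeff (U *ₚ Xpow a) (U *ₚ [ - 1ℚ ]) i)
        (cong (w +ℚ_) (trans (at (*ₚ-constʳ U (- 1ℚ)) i) (scale-coeff (- 1ℚ) U i))))

infix 4 _∣ₚ_
_∣ₚ_ : Poly → Poly → Set
p ∣ₚ q = Σ Poly λ c → q ≋ c *ₚ p

∣ₚ-respʳ : ∀ {p q q'} → q ≋ q' → p ∣ₚ q → p ∣ₚ q'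
∣ₚ-respʳ e (c , h) = c , ≋-trans (≋-sym e) h

∣ₚ-*-mono : ∀ {p q p' q'} → p ∣ₚ q → p' ∣ₚ q' → (p *ₚ p') ∣ₚ (q *ₚ q')
∣ₚ-*-mono {p} {q} {p'} {q'} (c , h) (c' , h') =
  (c *ₚ c') , ≋-trans (*ₚ-cong h h') (*ₚ-interchange c p c' p')

∣ₚ-^-mono : ∀ {p q} n → p ∣ₚ q → (p ^ₚ n) ∣ₚ (q ^ₚ n)
∣ₚ-^-mono zero    _   = oneₚ , ≋-sym (*ₚ-identityˡ oneₚ)
∣ₚ-^-mono (suc n) p∣q = ∣ₚ-*-mono p∣q (∣ₚ-^-mono n p∣q)

-- X^a - 1 divides X^{ba} - 1, with quotient 1 + X^a + ⋯ + X^{(b-1)a}.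
XpowMinus1-∣ₚ-multiple : ∀ a b → XpowMinus1 a ∣ₚ XpowMinus1 (b ℕ.* a)
XpowMinus1-∣ₚ-multiple a zero    = [] , mk λ { zero → solve 0 (con 1ℚ :+ con (- 1ℚ) := con 0ℚ) refl
                                             ; (suc i) → refl }
XpowMinus1-∣ₚ-multiple a (suc b) with XpowMinus1-∣ₚ-multiple a b
... | c , h = (Xpow (b ℕ.* a) +ₚ c) , (begin
    XpowMinus1 (a ℕ.+ b ℕ.* a)                                 ≈⟨ XpowMinus1-+ a (b ℕ.* a) ⟩
    (Xpow (b ℕ.* a) *ₚ XpowMinus1 a) +ₚ XpowMinus1 (b ℕ.* a)   ≈⟨ +ₚ-cong {Xpow (b ℕ.* a) *ₚ XpowMinus1 a} ≋-refl h ⟩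
    (Xpow (b ℕ.* a) *ₚ XpowMinus1 a) +ₚ (c *ₚ XpowMinus1 a)    ≈⟨ ≋-sym (*ₚ-distribʳ (Xpow (b ℕ.* a)) c (XpowMinus1 a)) ⟩
    (Xpow (b ℕ.* a) +ₚ c) *ₚ XpowMinus1 a                      ∎)
  where open SetoidReasoning PolySetoid

XpowMinus1-∣ₚ : ∀ {a M} → a ∣ M → XpowMinus1 a ∣ₚ XpowMinus1 M
XpowMinus1-∣ₚ {a} (divides b refl) = XpowMinus1-∣ₚ-multiple a b

partialDenom : ∀ {s} → (n k : Fin s → ℕ) → List (Fin s) → Poly
partialDenom n k = foldr (λ j acc → (XpowMinus1 (k j) ^ₚ n j) *ₚ acc) oneₚ

partialDenom-∣ₚ : ∀ {s} (n k : Fin s → ℕ) {M} → (∀ j → k j ∣ M) → ∀ js →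
  partialDenom n k js ∣ₚ (XpowMinus1 M ^ₚ sum (map n js))
partialDenom-∣ₚ n k     k∣M []       = oneₚ , ≋-sym (*ₚ-identityˡ oneₚ)
partialDenom-∣ₚ n k {M} k∣M (j ∷ js) =
  ∣ₚ-respʳ (≋-sym (^ₚ-+ (XpowMinus1 M) (n j) (sum (map n js))))
    (∣ₚ-*-mono (∣ₚ-^-mono (n j) (XpowMinus1-∣ₚ (k∣M j))) (partialDenom-∣ₚ n k k∣M js))

product-positive : ∀ {A : Set} (f : A → ℕ) → (∀ x → 1 ≤ f x) → ∀ xs → 1 ≤ product (map f xs)
product-positive f 1≤f []       = ≤-refl
product-positive f 1≤f (x ∷ xs) = *-mono-≤ (1≤f x) (product-positive f 1≤f xs)

inverse-as-term : ∀ D E g → E ≋ g *ₚ D → (oneₚ // D) ≃ sumF [ g // E ]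
inverse-as-term D E g E≋gD = at (begin
    oneₚ *ₚ (E *ₚ oneₚ)                  ≈⟨ *ₚ-identityˡ (E *ₚ oneₚ) ⟩
    E *ₚ oneₚ                            ≈⟨ *ₚ-identityʳ E ⟩
    E                                    ≈⟨ E≋gD ⟩
    g *ₚ D                               ≈⟨ *ₚ-congˡ g ((g *ₚ oneₚ) +ₚ []) D
                                              (≋-sym (≋-trans (+ₚ-identityʳ (g *ₚ oneₚ)) (*ₚ-identityʳ g))) ⟩
    ((g *ₚ oneₚ) +ₚ []) *ₚ D             ∎)
  where open SetoidReasoning PolySetoid

lemma1 : (s : ℕ) → 1 ≤ s → (n k : Fin s → ℕ) → (∀ j → 1 ≤ n j) → (∀ j → 1 ≤ k j) →
    ∃[ ts ] (All (λ { (g , m , ℓ) → (1 ≤ m) × (1 ≤ ℓ) × (ℓ ≤ sumFin s n) }) ts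
    × ((oneₚ // denom s n k) ≃ sumF (map term ts)))
lemma1 (suc s) _ n k 1≤n 1≤k =
  [ g , M , L ] , (1≤M , 1≤L , ≤-refl) ∷ [] , inverse-as-term (denom (suc s) n k) (XpowMinus1 M ^ₚ L) g E≋gD
  where
  js : List (Fin (suc s))
  js = allFin (suc s)
  M L : ℕ
  M = product (map k js)
  L = sumFin (suc s) n
  1≤M : 1 ≤ M
  1≤M = product-positive k 1≤k js
  1≤L : 1 ≤ L
  1≤L = ≤-trans (1≤n fzero) (m≤m+n (n fzero) _)
  kⱼ∣M : ∀ j → k j ∣ M
  kⱼ∣M j = ∈⇒∣product (∈-map⁺ k (∈-allFin j))
  D∣E : denom (suc s) n k ∣ₚ (XpowMinus1 M ^ₚ L)
  D∣E = partialDenom-∣ₚ n k kⱼ∣M js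
  g : Poly
  g = proj₁ D∣E
  E≋gD : XpowMinus1 M ^ₚ L ≋ g *ₚ denom (suc s) n k
  E≋gD = proj₂ D∣E
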